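{- Let $n\ge2$, $n_1=n(n+1)/2$, let $[G]$ be a binding graph of order $n_1$, and let $\mathrm{wl}([G])=(m_{ij})$. Let $u,v,r,s\in[n]$ with $u\ne v$, $r\neq s$, let $p=u\wedge v$ and $q=r\wedge s$, and suppose $(u,v)$ is an edge of $[G]$. Then: (1) if $(r,s)$ is a non-edge of $[G]$, then $\{m_{pu},m_{up},m_{pv},m_{vp}\}\cap\{m_{qr},m_{rq},m_{qs},m_{sq}\}=\emptyset$; (2) if $n>2$, then $m_{uv}\notin\{m_{qr},m_{rq},m_{qs},m_{sq}\}$.
   Context: Labeled graphs: $\mathrm{Var}$ is an infinite set of independent variables and $x_0\notin\mathrm{Var}$ a reserved symbol. A labeled graph of order $N$ is an $N\times N$ matrix $G=(g_{ij})$ with entries in $\{x_0\}\cup\mathrm{Var}$; vertex set $[N]$; for $i\neq j$, $(i,j)$ is an edge iff $g_{ij}\ne x_0$ and a non-edge otherwise. $\dim(G)$ is the number of distinct symbols in $G$. A simple graph has $G^\top=G$, $\dim(G)\le2$, $g_{ii}=x_0$. Diamond product: $(G\diamond G)_{ij}=\{\!\{(g_{ik},g_{kj}):k\in[N]\}\!\}$. $\mathrm{evs}(A)$ replaces entries of $A$ by variables of $\mathrm{Var}$ so that equal entries get equal variables and distinct entries distinct ones. WL algorithm: $G_1$ from $G$ by replacing diagonal entries by fresh variables (equal iff equal before, none occurring off-diagonal), $G_{t+1}=\mathrm{evs}(G_t\diamond G_t)$ until $\dim(G_t)=\dim(G_{t+1})$, $\mathrm{wl}(G):=G_t$ (a representative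 is fixed). Binding graphs: a binding graph of order $n_1=n(n+1)/2$ is a simple graph such that for every pair of distinct $u,v\in[n]$ there is a unique vertex $u\wedge v\in[n+1,n_1]$ whose neighbours are exactly $u$ and $v$, distinct pairs giving distinct vertices; its subgraph induced on $[n]$ is the basic graph $G$ and it is denoted $[G]$. -}

module Defs where

open import Data.Nat using (ℕ; zero; suc; _*_; _≤_; _<_)
open import Data.Nat.Properties using (_≟_)
open import Data.Nat.DivMod using (_/_)
open import Data.Fin using (Fin; toℕ)
open import Data.List using (List; []; _∷_; map; allFin; concatMap; deduplicate; length)
open import Data.List.Relation.Binary.Permutation.Propositional using (_↭_)
open import Data.List.Membership.Propositional using (_∈_)
open import Data.Product using (Σ; ∃; ∃!; _×_; _,_)
open import Data.Sum using (_⊎_)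
open import Data.Empty using (⊥)
open import Relation.Nullary using (¬_)
open import Relation.Binary.PropositionalEquality using (_≡_; _≢_)
open import Function.Bundles using (_⇔_)

Symbol : Set
Symbol = ℕ

x₀ : Symbol
x₀ = 0

IsVar : Symbol → Set
IsVar x = x ≢ x₀

-- A labeled graph of order N: an N × N matrix of symbols.
Mat : ℕ → Set
Mat N = Fin N → Fin N → Symbol

entries : ∀ {N} → Mat N → List Symbol
entries {N} A = concatMap (λ i → map (λ j → A i j) (allFin N)) (allFin N)

dim : ∀ {N} → Mat N → ℕ
dim A = length (deduplicate _≟_ (entries A))

Edge : ∀ {N} → Mat N → Fin N → Fin N → Set
Edge G i j = i ≢ j × G i j ≢ x₀

NonEdge : ∀ {N} → Mat N → Fin N → Fin N → Set
NonEdge G i j = i ≢ j × G i j ≡ x₀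

IsSimple : ∀ {N} → Mat N → Set
IsSimple G = (∀ i j → G i j ≡ G j i) × dim G ≤ 2 × (∀ i → G i i ≡ x₀)

-- The (i,j) entry of the diamond product G ◇ G, as the list of pairs
-- (g_ik, g_kj), k ∈ [N]; it is read as a multiset (compared up to permutation).
diamond : ∀ {N} → Mat N → Fin N → Fin N → List (Symbol × Symbol)
diamond {N} A i j = map (λ k → (A i k , A k j)) (allFin N)

-- B is (a representative of) evs(A ◇ A): entries of B are variables, and
-- two entries of B are equal iff the corresponding multisets are equal.
IsEvsDiamond : ∀ {N} → Mat N → Mat N → Set
IsEvsDiamond A B =
  (∀ i j k l → (B i j ≡ B k l) ⇔ (diamond A i j ↭ diamond A k l))
  × (∀ i j → IsVar (B i j))

IsInit : ∀ {N} → Mat N → Mat N → Set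
IsInit G G₁ =
  (∀ i j → i ≢ j → G₁ i j ≡ G i j)
  × (∀ i j → (G₁ i i ≡ G₁ j j) ⇔ (G i i ≡ G j j))
  × (∀ i → IsVar (G₁ i i))
  × (∀ i k l → k ≢ l → G₁ i i ≢ G k l)

-- WLRun A M: iterating G_{t+1} = evs(G_t ◇ G_t) from A, the first G_t with
-- dim(G_t) = dim(G_{t+1}) is M.
data WLRun {N : ℕ} : Mat N → Mat N → Set where
  stop : ∀ {A B} → IsEvsDiamond A B → dim A ≡ dim B → WLRun A A
  step : ∀ {A B C} → IsEvsDiamond A B → dim A ≢ dim B → WLRun B C → WLRun A C

IsWL : ∀ {N} → Mat N → Mat N → Set
IsWL G M = Σ (Mat _) λ G₁ → IsInit G G₁ × WLRun G₁ M

order : ℕ → ℕ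
order n = (n * suc n) / 2

-- Basic vertices [n] and binding vertices [n+1, n₁] (0-indexed via toℕ).
IsBasic : ∀ {N} → ℕ → Fin N → Set
IsBasic n i = toℕ i < n

IsUpper : ∀ {N} → ℕ → Fin N → Set
IsUpper n i = n ≤ toℕ i

-- w is a vertex in [n+1,n₁] whose neighbours are exactly u and v (w = u ∧ v).
IsWedge : ∀ {N} → ℕ → Mat N → Fin N → Fin N → Fin N → Set
IsWedge n G u v w = IsUpper n w × (∀ x → Edge G w x ⇔ (x ≡ u ⊎ x ≡ v))

IsBinding : (n : ℕ) → Mat (order n) → Set
IsBinding n G =
  IsSimple G
  × (∀ u v → IsBasic n u → IsBasic n v → u ≢ v → ∃! _≡_ (IsWedge n G u v))
  × (∀ u v r s w → IsBasic n u → IsBasic n v → IsBasic n r → IsBasic n s →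
       u ≢ v → r ≢ s → IsWedge n G u v w → IsWedge n G r s w →
       (u ≡ r × v ≡ s) ⊎ (u ≡ s × v ≡ r))

_∉_ : ∀ {A : Set} → A → List A → Set
x ∉ xs = ¬ (x ∈ xs)

Disjoint : ∀ {A : Set} → List A → List A → Set
Disjoint xs ys = ∀ x → x ∈ xs → x ∉ ys

-- wl([G]) is a stable colouring: the last WL step creates no new colour, and a
-- refinement with as many colours as the original one splits no class. It also
-- refines [G], and diagonal colours never occur off the diagonal. Hence the
-- colour of (a,b) determines the colour of (a,a), thus the degree of a, and
-- whether a and b are joined by a path of length 2.
-- (1) Each of p-u, u-p, p-v, v-p is joined by a 2-path (through v resp. u),
-- while if r ≁ s there is no 2-path between q = r∧s and r or s: the only
-- neighbours of q are r and s.
-- (2) For n > 2 pick a third basic vertex w; then v, u∧v and u∧w are three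
-- distinct neighbours of u (likewise for v), whereas q has degree 2.
module Submission where

open import Defs
open import Data.Nat.Base using (ℕ; zero; suc; _≤_; _<_; z≤n; s≤s)
open import Data.Nat.Properties using (≤-trans; <-≤-trans; <-irrefl; <⇒≱)
import Data.Nat.Properties as ℕ
open import Data.Fin.Base using (Fin; toℕ; fromℕ<)
open import Data.Fin.Properties using (toℕ<n; toℕ-fromℕ<)
import Data.Fin.Properties as Fin
open import Data.List.Base
  using (List; []; _∷_; map; filter; allFin; deduplicate; length; cartesianProduct)
open import Data.List.Properties using (filter-notAll; filter-≐; length-map)
open import Data.List.Membership.Propositional using (_∈_; lose; find)
open import Data.List.Membership.Propositional.Properties
  using (∈-map⁺; ∈-map⁻; ∈-filter⁺; ∈-filter⁻; ∈-concatMap⁺; ∈-concatMap⁻;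
         ∈-deduplicate⁺; ∈-deduplicate⁻; ∈-cartesianProduct⁺; ∈-allFin)
open import Data.List.Membership.DecPropositional ℕ._≟_ using (_∈?_)
open import Data.List.Relation.Binary.Subset.Propositional using (_⊆_)
open import Data.List.Relation.Unary.Any using (here; there)
import Data.List.Relation.Unary.Any as Any
import Data.List.Relation.Unary.All as All
open import Data.List.Relation.Unary.AllPairs using (_∷_; [])
open import Data.List.Relation.Unary.Unique.Propositional using (Unique)
import Data.List.Relation.Unary.Unique.Propositional.Properties as Unique
open import Data.List.Relation.Unary.Unique.DecPropositional.Properties using (deduplicate-!)
open import Data.List.Relation.Binary.Permutation.Propositional using (_↭_)
open import Data.List.Relation.Binary.Permutation.Propositional.Properties
  using (filter-↭; ∈-resp-↭; ↭-length)
open import Data.Product using (∃; ∃₂; _×_; _,_; proj₁; proj₂; uncurry)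
open import Data.Sum using (_⊎_; inj₁; inj₂)
import Data.Sum as Sum
open import Data.Bool.Base using (true; false)
open import Data.Empty using (⊥; ⊥-elim)
open import Function using (_∘_)
open import Function.Bundles using (Equivalence; mk⇔)
open import Relation.Nullary using (¬_; Dec; yes; no; does)
open import Relation.Nullary.Decidable using (¬?)
open import Relation.Unary using (Pred; Decidable)
open import Relation.Binary.Definitions using (DecidableEquality)
open import Relation.Binary.PropositionalEquality
  using (_≡_; _≢_; refl; sym; trans; cong; subst; ≢-sym; module ≡-Reasoning)

open Equivalence using (to; from)

unique-⊆⇒length≤ : ∀ {A : Set} → DecidableEquality A → {xs ys : List A} →
                   Unique xs → xs ⊆ ys → length xs ≤ length ys
unique-⊆⇒length≤ _≟_ {[]} _ _ = z≤n
unique-⊆⇒length≤ _≟_ {x ∷ xs} {ys} (x∉xs ∷ xs-unique) x∷xs⊆ys =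
  ≤-trans (s≤s (unique-⊆⇒length≤ _≟_ xs-unique xs⊆ys-x))
          (filter-notAll ≢x? ys (Any.map (λ x≡y x≢y → x≢y x≡y) (x∷xs⊆ys (here refl))))
  where
  ≢x? = λ y → ¬? (x ≟ y)
  xs⊆ys-x : xs ⊆ filter ≢x? ys
  xs⊆ys-x y∈xs = ∈-filter⁺ ≢x? (x∷xs⊆ys (there y∈xs)) (All.lookup x∉xs y∈xs)

filter-map : ∀ {A B : Set} {p} {P : Pred B p} (P? : Decidable P) (f : A → B) (xs : List A) →
             filter P? (map f xs) ≡ map f (filter (P? ∘ f) xs)
filter-map P? f [] = refl
filter-map P? f (x ∷ xs) with does (P? (f x))
... | true = cong (f x ∷_) (filter-map P? f xs)
... | false = filter-map P? f xs

assoc : ∀ {A B : Set} → DecidableEquality A → B → List (A × B) → A → B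
assoc _≟_ default [] a = default
assoc _≟_ default ((a′ , b) ∷ table) a with a′ ≟ a
... | yes _ = b
... | no _ = assoc _≟_ default table a

assoc-∈ : ∀ {A B : Set} (_≟_ : DecidableEquality A) (default : B) (table : List (A × B)) {a b} →
          (a , b) ∈ table → (a , assoc _≟_ default table a) ∈ table
assoc-∈ _≟_ default ((a′ , b′) ∷ table) {a} entry with a′ ≟ a
... | yes refl = here refl
assoc-∈ _≟_ default (_ ∷ table) (here refl) | no a≢a = ⊥-elim (a≢a refl)
assoc-∈ _≟_ default (_ ∷ table) (there entry) | no _ = there (assoc-∈ _≟_ default table entry)

avoid-two : (a b : ℕ) → ∃ λ w → w < 3 × w ≢ a × w ≢ b
avoid-two zero zero = 1 , s≤s (s≤s z≤n) , (λ ()) , (λ ())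
avoid-two zero (suc zero) = 2 , s≤s (s≤s (s≤s z≤n)) , (λ ()) , (λ ())
avoid-two zero (suc (suc b)) = 1 , s≤s (s≤s z≤n) , (λ ()) , (λ ())
avoid-two (suc zero) zero = 2 , s≤s (s≤s (s≤s z≤n)) , (λ ()) , (λ ())
avoid-two (suc (suc a)) zero = 1 , s≤s (s≤s z≤n) , (λ ()) , (λ ())
avoid-two (suc a) (suc b) = 0 , s≤s z≤n , (λ ()) , (λ ())

module _ {N : ℕ} where

  positions : List (Fin N × Fin N)
  positions = cartesianProduct (allFin N) (allFin N)

  ∈-positions : ∀ i j → (i , j) ∈ positions
  ∈-positions i j = ∈-cartesianProduct⁺ (∈-allFin i) (∈-allFin j)

  ∈-entries⁺ : (A : Mat N) (i j : Fin N) → A i j ∈ entries A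
  ∈-entries⁺ A i j =
    ∈-concatMap⁺ (λ i → map (A i) (allFin N)) (lose (∈-allFin i) (∈-map⁺ (A i) (∈-allFin j)))

  ∈-entries⁻ : (A : Mat N) {x : Symbol} → x ∈ entries A → ∃₂ λ i j → x ≡ A i j
  ∈-entries⁻ A x∈A with find (∈-concatMap⁻ (λ i → map (A i) (allFin N)) {xs = allFin N} x∈A)
  ... | i , _ , x∈row with ∈-map⁻ (A i) x∈row
  ... | j , _ , x≡Aij = i , j , x≡Aij

  _Refines_ : Mat N → Mat N → Set
  B Refines A = ∀ i j k l → B i j ≡ B k l → A i j ≡ A k l

  refines-trans : ∀ {A B C} → C Refines B → B Refines A → C Refines A
  refines-trans C⊑B B⊑A i j k l = B⊑A i j k l ∘ C⊑B i j k l

  refines⇒factors : ∀ {A B} → B Refines A → ∃ λ h → ∀ i j → h (B i j) ≡ A i j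
  refines⇒factors {A} {B} B⊑A = h , h-correct
    where
    colours : Fin N × Fin N → Symbol × Symbol
    colours (i , j) = B i j , A i j
    table = map colours positions
    h = assoc ℕ._≟_ x₀ table
    h-correct : ∀ i j → h (B i j) ≡ A i j
    h-correct i j with ∈-map⁻ colours (assoc-∈ ℕ._≟_ x₀ table (∈-map⁺ colours (∈-positions i j)))
    ... | (k , l) , _ , eq = trans (cong proj₂ eq) (sym (B⊑A i j k l (cong proj₁ eq)))

  values : Mat N → List Symbol
  values A = deduplicate ℕ._≟_ (entries A)

  ∈-values : (A : Mat N) (i j : Fin N) → A i j ∈ values A
  ∈-values A i j = ∈-deduplicate⁺ ℕ._≟_ (∈-entries⁺ A i j)

  split⇒dim< : ∀ {A B i j k l} → B Refines A → A i j ≡ A k l → B i j ≢ B k l → dim A < dim B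
  split⇒dim< {A} {B} {i} {j} {k} {l} B⊑A Aij≡Akl Bij≢Bkl = begin-strict
    dim A                 ≤⟨ unique-⊆⇒length≤ ℕ._≟_ (deduplicate-! ℕ._≟_ (entries A)) values-A⊆ ⟩
    length (map h others) ≡⟨ length-map h others ⟩
    length others         <⟨ filter-notAll ≢Bij? (values B) (Any.map (λ e ne → ne (sym e)) (∈-values B i j)) ⟩
    dim B                 ∎
    where
    open ℕ.≤-Reasoning
    h = proj₁ (refines⇒factors B⊑A)
    h-correct = proj₂ (refines⇒factors B⊑A)
    ≢Bij? = λ c → ¬? (c ℕ.≟ B i j)
    others = filter ≢Bij? (values B)
    ∈-others : ∀ x y → B x y ≢ B i j → h (B x y) ∈ map h others
    ∈-others x y ne = ∈-map⁺ h (∈-filter⁺ ≢Bij? (∈-values B x y) ne)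
    -- a value A x y either lies in B's class of (i,j), where A is constantly A k l, or outside it
    values-A⊆ : values A ⊆ map h others
    values-A⊆ x∈A with ∈-entries⁻ A (∈-deduplicate⁻ ℕ._≟_ (entries A) x∈A)
    ... | x , y , refl with B x y ℕ.≟ B i j
    ... | yes Bxy≡Bij = subst (_∈ map h others)
                          (trans (h-correct k l) (sym (trans (B⊑A x y i j Bxy≡Bij) Aij≡Akl)))
                          (∈-others k l (≢-sym Bij≢Bkl))
    ... | no Bxy≢Bij = subst (_∈ map h others) (h-correct x y) (∈-others x y Bxy≢Bij)

  dim≡⇒refines : ∀ {A B} → B Refines A → dim A ≡ dim B → A Refines B
  dim≡⇒refines {A} {B} B⊑A dimA≡dimB i j k l Aij≡Akl with B i j ℕ.≟ B k l
  ... | yes Bij≡Bkl = Bij≡Bkl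
  ... | no Bij≢Bkl = ⊥-elim (<-irrefl dimA≡dimB (split⇒dim< B⊑A Aij≡Akl Bij≢Bkl))

  DiagonalSeparated : Mat N → Set
  DiagonalSeparated A = ∀ i k l → k ≢ l → A i i ≢ A k l

  Stable : Mat N → Set
  Stable A = ∀ i j k l → A i j ≡ A k l → diamond A i j ↭ diamond A k l

  ∈-diamond⁺ : (A : Mat N) (i j m : Fin N) → (A i m , A m j) ∈ diamond A i j
  ∈-diamond⁺ A i j m = ∈-map⁺ (λ k → A i k , A k j) (∈-allFin m)

  ∈-diamond⁻ : (A : Mat N) {i j : Fin N} {x : Symbol × Symbol} →
               x ∈ diamond A i j → ∃ λ m → x ≡ (A i m , A m j)
  ∈-diamond⁻ A {i} {j} x∈ with ∈-map⁻ (λ k → A i k , A k j) x∈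
  ... | m , _ , eq = m , eq

  -- The pair (A i i , A i j) must be matched by the summand at m = k,
  -- since A i i can only occur on the diagonal.
  diamond-↭⇒source : ∀ {A i j k l} → DiagonalSeparated A → diamond A i j ↭ diamond A k l →
                     A i i ≡ A k k × A i j ≡ A k l
  diamond-↭⇒source {A} {i} {j} {k} sep i,j↭k,l
    with ∈-diamond⁻ A (∈-resp-↭ i,j↭k,l (∈-diamond⁺ A i j i))
  ... | m , eq with k Fin.≟ m
  ... | yes refl = cong proj₁ eq , cong proj₂ eq
  ... | no k≢m = ⊥-elim (sep i k m k≢m (cong proj₁ eq))

  diamond-↭⇒target : ∀ {A i j k l} → DiagonalSeparated A → diamond A i j ↭ diamond A k l →
                     A j j ≡ A l l
  diamond-↭⇒target {A} {i} {j} {k} {l} sep i,j↭k,l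
    with ∈-diamond⁻ A (∈-resp-↭ i,j↭k,l (∈-diamond⁺ A i j j))
  ... | m , eq with m Fin.≟ l
  ... | yes refl = cong proj₂ eq
  ... | no m≢l = ⊥-elim (sep j m l m≢l (cong proj₂ eq))

  evs-refines : ∀ {A B} → DiagonalSeparated A → IsEvsDiamond A B → B Refines A
  evs-refines sep (evs , _) i j k l = proj₂ ∘ diamond-↭⇒source sep ∘ to (evs i j k l)

  evs-diagonalSeparated : ∀ {A B} → DiagonalSeparated A → IsEvsDiamond A B → DiagonalSeparated B
  evs-diagonalSeparated sep ev i k l k≢l = sep i k l k≢l ∘ evs-refines sep ev i i k l

  evs-stable : ∀ {A B} → DiagonalSeparated A → IsEvsDiamond A B → dim A ≡ dim B → Stable A
  evs-stable sep ev dimA≡dimB i j k l =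
    to (proj₁ ev i j k l) ∘ dim≡⇒refines (evs-refines sep ev) dimA≡dimB i j k l

  wlRun-diagonalSeparated : ∀ {A M} → WLRun A M → DiagonalSeparated A → DiagonalSeparated M
  wlRun-diagonalSeparated (stop _ _) sep = sep
  wlRun-diagonalSeparated (step ev _ run) sep =
    wlRun-diagonalSeparated run (evs-diagonalSeparated sep ev)

  wlRun-refines : ∀ {A M} → WLRun A M → DiagonalSeparated A → M Refines A
  wlRun-refines (stop _ _) _ _ _ _ _ eq = eq
  wlRun-refines (step ev _ run) sep =
    refines-trans (wlRun-refines run (evs-diagonalSeparated sep ev)) (evs-refines sep ev)

  wlRun-stable : ∀ {A M} → WLRun A M → DiagonalSeparated A → Stable M
  wlRun-stable (stop ev dimA≡dimB) sep = evs-stable sep ev dimA≡dimB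
  wlRun-stable (step ev _ run) sep = wlRun-stable run (evs-diagonalSeparated sep ev)

  init-diagonalSeparated : ∀ {G G₁} → IsInit G G₁ → DiagonalSeparated G₁
  init-diagonalSeparated (off-diagonal , _ , _ , fresh) i k l k≢l eq =
    fresh i k l k≢l (trans eq (off-diagonal k l k≢l))

  record IsStableColouring (G M : Mat N) : Set where
    field
      diagonalSeparated : DiagonalSeparated M
      stable            : Stable M
      Edge-resp         : ∀ {i j k l} → M i j ≡ M k l → Edge G k l → Edge G i j

  wl-isStableColouring : ∀ {G M} → IsWL G M → IsStableColouring G M
  wl-isStableColouring {G} {M} (G₁ , init@(off-diagonal , _) , run) = record
    { diagonalSeparated = wlRun-diagonalSeparated run sep
    ; stable            = wlRun-stable run sep
    ; Edge-resp         = Edge-resp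
    }
    where
    sep = init-diagonalSeparated init
    Edge-resp : ∀ {i j k l} → M i j ≡ M k l → Edge G k l → Edge G i j
    Edge-resp {i} {j} {k} {l} Mij≡Mkl (k≢l , Gkl≢x₀) with i Fin.≟ j
    ... | yes refl = ⊥-elim (wlRun-diagonalSeparated run sep i k l k≢l Mij≡Mkl)
    ... | no i≢j = i≢j , λ Gij≡x₀ → Gkl≢x₀ (begin
      G k l   ≡⟨ off-diagonal k l k≢l ⟨
      G₁ k l  ≡⟨ wlRun-refines run sep i j k l Mij≡Mkl ⟨
      G₁ i j  ≡⟨ off-diagonal i j i≢j ⟩
      G i j   ≡⟨ Gij≡x₀ ⟩
      x₀      ∎)
      where open ≡-Reasoning

  Symmetric : Mat N → Set
  Symmetric G = ∀ i j → G i j ≡ G j i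

  Edge-sym : ∀ {G i j} → Symmetric G → Edge G i j → Edge G j i
  Edge-sym {G} {i} {j} symmetric (i≢j , Gij≢x₀) = ≢-sym i≢j , Gij≢x₀ ∘ trans (symmetric i j)

  Edge? : (G : Mat N) (i j : Fin N) → Dec (Edge G i j)
  Edge? G i j with i Fin.≟ j | G i j ℕ.≟ x₀
  ... | yes i≡j | _ = no (λ e → proj₁ e i≡j)
  ... | no _ | yes Gij≡x₀ = no (λ e → proj₂ e Gij≡x₀)
  ... | no i≢j | no Gij≢x₀ = yes (i≢j , Gij≢x₀)

  TwoPath : Mat N → Fin N → Fin N → Set
  TwoPath G a b = ∃ λ m → Edge G a m × Edge G m b

  TwoPath-sym : ∀ {G a b} → Symmetric G → TwoPath G a b → TwoPath G b a
  TwoPath-sym symmetric (m , am , mb) = m , Edge-sym symmetric mb , Edge-sym symmetric am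

  degree : Mat N → Fin N → ℕ
  degree G i = length (filter (Edge? G i) (allFin N))

  degree≤2 : ∀ {G i a b} → (∀ k → Edge G i k → k ≡ a ⊎ k ≡ b) → degree G i ≤ 2
  degree≤2 {G} {i} {a} {b} neighbours =
    unique-⊆⇒length≤ Fin._≟_ (Unique.filter⁺ (Edge? G i) (Unique.allFin⁺ N)) ⊆a∷b
    where
    ⊆a∷b : filter (Edge? G i) (allFin N) ⊆ a ∷ b ∷ []
    ⊆a∷b k∈ with neighbours _ (proj₂ (∈-filter⁻ (Edge? G i) {xs = allFin N} k∈))
    ... | inj₁ k≡a = here k≡a
    ... | inj₂ k≡b = there (here k≡b)

  3≤degree : ∀ {G i a b c} → a ≢ b → a ≢ c → b ≢ c →
             Edge G i a → Edge G i b → Edge G i c → 3 ≤ degree G i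
  3≤degree {G} {i} {a} {b} {c} a≢b a≢c b≢c ia ib ic =
    unique-⊆⇒length≤ Fin._≟_ ((a≢b All.∷ a≢c All.∷ All.[]) ∷ (b≢c All.∷ All.[]) ∷ All.[] ∷ []) ⊆nbrs
    where
    nbr : ∀ {k} → Edge G i k → k ∈ filter (Edge? G i) (allFin N)
    nbr {k} = ∈-filter⁺ (Edge? G i) (∈-allFin k)
    ⊆nbrs : a ∷ b ∷ c ∷ [] ⊆ filter (Edge? G i) (allFin N)
    ⊆nbrs (here refl) = nbr ia
    ⊆nbrs (there (here refl)) = nbr ib
    ⊆nbrs (there (there (here refl))) = nbr ic

  module _ {G M : Mat N} (colouring : IsStableColouring G M) where
    open IsStableColouring colouring

    TwoPath-resp : ∀ {a b c d} → M a b ≡ M c d → TwoPath G a b → TwoPath G c d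
    TwoPath-resp {a} {b} {c} {d} Mab≡Mcd (m , am , mb)
      with ∈-diamond⁻ M (∈-resp-↭ (stable a b c d Mab≡Mcd) (∈-diamond⁺ M a b m))
    ... | m′ , eq = m′ , Edge-resp (sym (cong proj₁ eq)) am , Edge-resp (sym (cong proj₂ eq)) mb

    edgeColours : List Symbol
    edgeColours = map (uncurry M) (filter (uncurry (Edge? G)) positions)

    ∈-edgeColours⁺ : ∀ {i j} → Edge G i j → M i j ∈ edgeColours
    ∈-edgeColours⁺ {i} {j} e = ∈-map⁺ (uncurry M) (∈-filter⁺ (uncurry (Edge? G)) (∈-positions i j) e)

    ∈-edgeColours⁻ : ∀ {i j} → M i j ∈ edgeColours → Edge G i j
    ∈-edgeColours⁻ Mij∈ with ∈-map⁻ (uncurry M) Mij∈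
    ... | (k , l) , kl∈ , eq = Edge-resp eq (proj₂ (∈-filter⁻ (uncurry (Edge? G)) {xs = positions} kl∈))

    isEdgeColour? : (x : Symbol × Symbol) → Dec (proj₁ x ∈ edgeColours)
    isEdgeColour? x = proj₁ x ∈? edgeColours

    -- The degree of i is readable from the multiset (M i k , M k i)ₖ, i.e. from M i i.
    degree≡diamond : ∀ i → degree G i ≡ length (filter isEdgeColour? (diamond M i i))
    degree≡diamond i = begin
      length (filter (Edge? G i) (allFin N))
        ≡⟨ cong length (filter-≐ (Edge? G i) (isEdgeColour? ∘ row) (∈-edgeColours⁺ , ∈-edgeColours⁻) (allFin N)) ⟩
      length (filter (isEdgeColour? ∘ row) (allFin N))
        ≡⟨ length-map row (filter (isEdgeColour? ∘ row) (allFin N)) ⟨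
      length (map row (filter (isEdgeColour? ∘ row) (allFin N)))
        ≡⟨ cong length (filter-map isEdgeColour? row (allFin N)) ⟨
      length (filter isEdgeColour? (diamond M i i)) ∎
      where
      open ≡-Reasoning
      row : Fin N → Symbol × Symbol
      row k = M i k , M k i

    degree-resp : ∀ {i k} → M i i ≡ M k k → degree G i ≡ degree G k
    degree-resp {i} {k} Mii≡Mkk = begin
      degree G i                                      ≡⟨ degree≡diamond i ⟩
      length (filter isEdgeColour? (diamond M i i))   ≡⟨ ↭-length (filter-↭ isEdgeColour? (stable i i k k Mii≡Mkk)) ⟩
      length (filter isEdgeColour? (diamond M k k))   ≡⟨ degree≡diamond k ⟨
      degree G k                                      ∎
      where open ≡-Reasoning

basic≢upper : ∀ {N n} {x y : Fin N} → IsBasic n x → IsUpper n y → x ≢ y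
basic≢upper x<n n≤y refl = <-irrefl refl (<-≤-trans x<n n≤y)

∃-basic-avoiding : ∀ {N n} → 2 < n → n ≤ N → (u v : Fin N) →
                   ∃ λ w → IsBasic n w × w ≢ u × w ≢ v
∃-basic-avoiding {N} {n} 2<n n≤N u v with avoid-two (toℕ u) (toℕ v)
... | w , w<3 , w≢u , w≢v =
  fromℕ< w<N , subst (_< n) (sym (toℕ-fromℕ< w<N)) w<n , avoids w≢u , avoids w≢v
  where
  w<n = <-≤-trans w<3 2<n
  w<N = <-≤-trans w<n n≤N
  avoids : ∀ {x} → w ≢ toℕ x → fromℕ< w<N ≢ x
  avoids w≢x refl = w≢x (sym (toℕ-fromℕ< w<N))

module _ {N n : ℕ} {G : Mat N} where

  wedge-edgeˡ : ∀ {u v p} → IsWedge n G u v p → Edge G p u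
  wedge-edgeˡ (_ , neighbours) = from (neighbours _) (inj₁ refl)

  wedge-edgeʳ : ∀ {u v p} → IsWedge n G u v p → Edge G p v
  wedge-edgeʳ (_ , neighbours) = from (neighbours _) (inj₂ refl)

  wedge-neighbours : ∀ {u v p} → IsWedge n G u v p → ∀ x → Edge G p x → x ≡ u ⊎ x ≡ v
  wedge-neighbours (_ , neighbours) x = to (neighbours x)

  wedge-swap : ∀ {u v p} → IsWedge n G u v p → IsWedge n G v u p
  wedge-swap (upper , neighbours) =
    upper , λ x → mk⇔ (Sum.swap ∘ to (neighbours x)) (from (neighbours x) ∘ Sum.swap)

  wedge-TwoPath : ∀ {u v p} → IsWedge n G u v p → Edge G v u → TwoPath G p u
  wedge-TwoPath wedge vu = _ , wedge-edgeʳ wedge , vu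

  wedge-¬TwoPath : ∀ {r s q} → IsWedge n G r s q → ¬ Edge G s r → ¬ TwoPath G q r
  wedge-¬TwoPath wedge ¬sr (m , qm , mr) with wedge-neighbours wedge m qm
  ... | inj₁ refl = proj₁ mr refl
  ... | inj₂ refl = ¬sr mr

  wedge-colours-disjoint : ∀ {M u v p r s q} → Symmetric G → IsStableColouring G M →
    IsWedge n G u v p → IsWedge n G r s q → Edge G u v → NonEdge G r s →
    Disjoint (M p u ∷ M u p ∷ M p v ∷ M v p ∷ []) (M q r ∷ M r q ∷ M q s ∷ M s q ∷ [])
  wedge-colours-disjoint {M} {u} {v} {p} {r} {s} {q} symmetric colouring wedge-p wedge-q uv (_ , Grs≡x₀)
    x x∈pairs x∈q-pairs = contradict (onTwoPath x∈pairs) (offTwoPaths x∈q-pairs)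
    where
    contradict : (∃₂ λ a b → M a b ≡ x × TwoPath G a b) → (∃₂ λ c d → M c d ≡ x × ¬ TwoPath G c d) → ⊥
    contradict (a , b , Mab≡x , ab) (c , d , Mcd≡x , ¬cd) =
      ¬cd (TwoPath-resp colouring (trans Mab≡x (sym Mcd≡x)) ab)
    pu = wedge-TwoPath wedge-p (Edge-sym symmetric uv)
    pv = wedge-TwoPath (wedge-swap wedge-p) uv
    ¬rs : ¬ Edge G r s
    ¬rs rs = proj₂ rs Grs≡x₀
    ¬qr = wedge-¬TwoPath wedge-q (¬rs ∘ Edge-sym symmetric)
    ¬qs = wedge-¬TwoPath (wedge-swap wedge-q) ¬rs
    onTwoPath : ∀ {y} → y ∈ (M p u ∷ M u p ∷ M p v ∷ M v p ∷ []) →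
                ∃₂ λ a b → M a b ≡ y × TwoPath G a b
    onTwoPath (here refl) = p , u , refl , pu
    onTwoPath (there (here refl)) = u , p , refl , TwoPath-sym symmetric pu
    onTwoPath (there (there (here refl))) = p , v , refl , pv
    onTwoPath (there (there (there (here refl)))) = v , p , refl , TwoPath-sym symmetric pv
    offTwoPaths : ∀ {y} → y ∈ (M q r ∷ M r q ∷ M q s ∷ M s q ∷ []) →
                  ∃₂ λ c d → M c d ≡ y × ¬ TwoPath G c d
    offTwoPaths (here refl) = q , r , refl , ¬qr
    offTwoPaths (there (here refl)) = r , q , refl , ¬qr ∘ TwoPath-sym symmetric
    offTwoPaths (there (there (here refl))) = q , s , refl , ¬qs
    offTwoPaths (there (there (there (here refl)))) = s , q , refl , ¬qs ∘ TwoPath-sym symmetric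

module _ {n : ℕ} {G : Mat (order n)} (binding : IsBinding n G) where

  private
    symmetric : Symmetric G
    symmetric = proj₁ (proj₁ binding)

  3≤degree-basic : ∀ {u v p} → 2 < n → IsBasic n u → IsBasic n v → u ≢ v →
                   Edge G u v → IsWedge n G u v p → 3 ≤ degree G u
  3≤degree-basic {u} {v} {p} 2<n bu bv u≢v uv wedge-p =
    3≤degree (basic≢upper bv (proj₁ wedge-p)) (basic≢upper bv (proj₁ wedge-p′)) p≢p′
             uv (adjacent-to-wedge wedge-p) (adjacent-to-wedge wedge-p′)
    where
    adjacent-to-wedge : ∀ {x q} → IsWedge n G u x q → Edge G u q
    adjacent-to-wedge = Edge-sym symmetric ∘ wedge-edgeˡ {G = G}
    n≤order = ≤-trans (proj₁ wedge-p) (ℕ.<⇒≤ (toℕ<n p))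
    w-avoiding = ∃-basic-avoiding 2<n n≤order u v
    w = proj₁ w-avoiding
    bw = proj₁ (proj₂ w-avoiding)
    w≢u = proj₁ (proj₂ (proj₂ w-avoiding))
    w≢v = proj₂ (proj₂ (proj₂ w-avoiding))
    p′ = proj₁ (proj₁ (proj₂ binding) u w bu bw (≢-sym w≢u))
    wedge-p′ = proj₁ (proj₂ (proj₁ (proj₂ binding) u w bu bw (≢-sym w≢u)))
    p≢p′ : p ≢ p′
    p≢p′ p≡p′ with proj₂ (proj₂ binding) u v u w p bu bv bu bw u≢v (≢-sym w≢u)
                     wedge-p (subst (IsWedge n G u w) (sym p≡p′) wedge-p′)
    ... | inj₁ (_ , v≡w) = w≢v (sym v≡w)
    ... | inj₂ (u≡w , _) = w≢u (sym u≡w)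

  edge-colour-∉-wedge-colours : ∀ {M u v p r s q} → IsStableColouring G M → 2 < n →
    IsBasic n u → IsBasic n v → u ≢ v → IsWedge n G u v p → IsWedge n G r s q → Edge G u v →
    M u v ∉ (M q r ∷ M r q ∷ M q s ∷ M s q ∷ [])
  edge-colour-∉-wedge-colours {M} {u} {v} {p} {r} {s} {q} colouring 2<n bu bv u≢v wedge-p wedge-q uv
    = λ { (here e) → source≢q e
        ; (there (here e)) → target≢q e
        ; (there (there (here e))) → source≢q e
        ; (there (there (there (here e)))) → target≢q e
        }
    where
    open IsStableColouring colouring
    degree-q≤2 = degree≤2 (wedge-neighbours {G = G} wedge-q)
    ≢diagonal-q : ∀ {a} → 3 ≤ degree G a → M a a ≢ M q q
    ≢diagonal-q 3≤degree-a Maa≡Mqq =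
      <⇒≱ 3≤degree-a (subst (_≤ 2) (sym (degree-resp colouring Maa≡Mqq)) degree-q≤2)
    source≢q : ∀ {x} → M u v ≢ M q x
    source≢q = ≢diagonal-q (3≤degree-basic 2<n bu bv u≢v uv wedge-p)
             ∘ proj₁ ∘ diamond-↭⇒source diagonalSeparated ∘ stable _ _ _ _
    target≢q : ∀ {x} → M u v ≢ M x q
    target≢q = ≢diagonal-q (3≤degree-basic 2<n bv bu (≢-sym u≢v) (Edge-sym symmetric uv) (wedge-swap {G = G} wedge-p))
             ∘ diamond-↭⇒target diagonalSeparated ∘ stable _ _ _ _

lemma6p1 : (n : ℕ) → 2 ≤ n → (G : Mat (order n)) → IsBinding n G →
    (M : Mat (order n)) → IsWL G M →
    (u v r s p q : Fin (order n)) →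
    IsBasic n u → IsBasic n v → IsBasic n r → IsBasic n s →
    u ≢ v → r ≢ s →
    IsWedge n G u v p → IsWedge n G r s q →
    Edge G u v →
    (NonEdge G r s →
      Disjoint (M p u ∷ M u p ∷ M p v ∷ M v p ∷ [])
               (M q r ∷ M r q ∷ M q s ∷ M s q ∷ []))
    × (2 < n → M u v ∉ (M q r ∷ M r q ∷ M q s ∷ M s q ∷ []))
lemma6p1 n _ G binding M wl u v r s p q bu bv _ _ u≢v _ wedge-p wedge-q uv =
    wedge-colours-disjoint (proj₁ (proj₁ binding)) colouring wedge-p wedge-q uv
  , λ 2<n → edge-colour-∉-wedge-colours binding colouring 2<n bu bv u≢v wedge-p wedge-q uv
  where
  colouring = wl-isStableColouring wl
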